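{- Let $m$ be odd and let $C$ be a Hamilton cycle of the grid graph $G(m,n)$. Then every row contains at least one turn of $C$.
   Context: $G(m,n)$ is the graph on cells $\{1,\dots,m\}\times\{1,\dots,n\}$ with $(a,b),(c,d)$ adjacent iff $|a-c|+|b-d|=1$. A row is the set of $m$ cells with a fixed second coordinate; a column is the set of $n$ cells with a fixed first coordinate. A Hamilton cycle is a cycle through every cell. A turn of a cycle is a cell of the cycle whose two incident cycle edges are one horizontal and one vertical. -}

module Defs where

open import Data.Nat using (ℕ; zero; suc; _+_; _*_; _≤_; _%_; ∣_-_∣)
open import Data.Nat.DivMod using (m%n<n)
open import Data.Fin using (Fin; toℕ; fromℕ<)
open import Data.Product using (_×_; _,_; proj₁; proj₂; Σ; ∃)
open import Data.Sum using (_⊎_)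
open import Relation.Binary.PropositionalEquality using (_≡_)
open import Function.Definitions using (Injective; Surjective)

Odd : ℕ → Set
Odd m = ∃ λ k → m ≡ suc (2 * k)

-- Cells of G(m,n): (a , b) with a the column index (first coordinate,
-- ranging over m values) and b the row index (second coordinate).
-- Coordinates are 0-indexed: Fin m stands for {1,…,m}.
Cell : ℕ → ℕ → Set
Cell m n = Fin m × Fin n

Adj : ∀ {m n} → Cell m n → Cell m n → Set
Adj (a , b) (c , d) = ∣ toℕ a - toℕ c ∣ + ∣ toℕ b - toℕ d ∣ ≡ 1

Horizontal : ∀ {m n} → Cell m n → Cell m n → Set
Horizontal p q = proj₂ p ≡ proj₂ q

Vertical : ∀ {m n} → Cell m n → Cell m n → Set
Vertical p q = proj₁ p ≡ proj₁ q

next : ∀ {k} → Fin (suc k) → Fin (suc k)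
next {k} i = fromℕ< (m%n<n (suc (toℕ i)) (suc k))

record HamiltonCycle (m n : ℕ) : Set where
  field
    len-1    : ℕ
    len≥3    : 3 ≤ suc len-1
    vertex   : Fin (suc len-1) → Cell m n
    injective  : Injective _≡_ _≡_ vertex
    surjective : Surjective _≡_ _≡_ vertex
    adjacent : ∀ i → Adj (vertex i) (vertex (next i))

open HamiltonCycle public

-- The cell at position (next i) of C is a turn: its two incident cycle
-- edges (from vertex i and to vertex (next (next i))) are one horizontal
-- and one vertical.
TurnAt : ∀ {m n} (C : HamiltonCycle m n) → Fin (suc (len-1 C)) → Set
TurnAt C i =
  (Horizontal u v × Vertical v w) ⊎ (Vertical u v × Horizontal v w)
  where
    u = vertex C i
    v = vertex C (next i)
    w = vertex C (next (next i))

IsTurn : ∀ {m n} (C : HamiltonCycle m n) → Cell m n → Set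
IsTurn C p = ∃ λ i → vertex C (next i) ≡ p × TurnAt C i

module Submission where

-- Suppose row b contains no turn of C. A horizontal stretch of C inside row b could then never
-- turn and would run past the last column, so C passes every cell of row b vertically, between
-- rows b - 1 and b + 1. Such a cell lies on exactly one cycle edge crossing the line between rows
-- b - 1 and b, and every crossing edge has exactly one end in row b, so C crosses that line m
-- times. A closed walk crosses it an even number of times, hence m is even. All counting is
-- modulo 2, as sums of Booleans under xor.

open import Algebra.Bundles using (CommutativeMonoid)
open import Data.Bool using (Bool; true; false; _xor_; _∧_; not; T)
open import Data.Bool.Properties
  using ( xor-comm; xor-assoc; xor-identity; xor-same; not-involutive
        ; ∧-comm; ∧-distribˡ-xor; ∧-distribʳ-xor )
open import Data.Fin using (Fin; zero; suc; toℕ; inject₁; fromℕ)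
open import Data.Fin.Properties
  using (_≟_; toℕ-injective; toℕ<n; toℕ≤pred[n]; toℕ-fromℕ<; toℕ-inject₁; toℕ-fromℕ; any?)
open import Data.Nat using (ℕ; zero; suc; _+_; _*_; _∸_; _≤_; s≤s; s≤s⁻¹; ∣_-_∣)
import Data.Nat.Properties as ℕ
open import Data.Nat.DivMod using (_%_; m<n⇒m%n≡m; n%n≡0)
open import Data.Product using (∃; _×_; _,_; proj₁; proj₂)
open import Data.Product.Properties using (≡-dec; ×-≡,≡→≡)
open import Data.Sum using (_⊎_; inj₁; inj₂)
open import Data.Unit using (tt)
open import Data.Vec.Functional using (Vector)
open import Function using (_∘_)
open import Level using (0ℓ)
open import Relation.Binary.PropositionalEquality
  using (_≡_; _≢_; refl; sym; trans; cong; cong₂; subst; module ≡-Reasoning)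
open import Relation.Binary.PropositionalEquality.Algebra using (isMagma)
open import Relation.Nullary using (¬_; Dec; yes; no; does; contradiction)
open import Relation.Nullary.Decidable
  using (_×-dec_; _⊎-dec_; map′; dec-true; dec-false; does-≡; decidable-stable)
open import Relation.Unary using (Pred; Decidable)

open import Defs

∣m-n∣≡1⇒m≡1+n⊎1+m≡n : ∀ m n → ∣ m - n ∣ ≡ 1 → m ≡ suc n ⊎ suc m ≡ n
∣m-n∣≡1⇒m≡1+n⊎1+m≡n zero    (suc n) e = inj₂ (cong suc (sym (ℕ.suc-injective e)))
∣m-n∣≡1⇒m≡1+n⊎1+m≡n (suc m) zero    e = inj₁ (cong suc (ℕ.suc-injective e))
∣m-n∣≡1⇒m≡1+n⊎1+m≡n (suc m) (suc n) e with ∣m-n∣≡1⇒m≡1+n⊎1+m≡n m n e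
... | inj₁ m≡1+n = inj₁ (cong suc m≡1+n)
... | inj₂ 1+m≡n = inj₂ (cong suc 1+m≡n)

opposite-neighbours : ∀ {x y c} → ∣ x - c ∣ ≡ 1 → ∣ y - c ∣ ≡ 1 → x ≢ y →
                      (x ≡ suc c × suc y ≡ c) ⊎ (suc x ≡ c × y ≡ suc c)
opposite-neighbours {x} {y} {c} xc yc x≢y
  with ∣m-n∣≡1⇒m≡1+n⊎1+m≡n x c xc | ∣m-n∣≡1⇒m≡1+n⊎1+m≡n y c yc
... | inj₁ refl | inj₁ refl = contradiction refl x≢y
... | inj₁ x≡   | inj₂ y≡   = inj₁ (x≡ , y≡)
... | inj₂ x≡   | inj₁ y≡   = inj₂ (x≡ , y≡)
... | inj₂ refl | inj₂ y≡   = contradiction (ℕ.suc-injective (sym y≡)) x≢y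

m+n≡1⇒m≡0⊎n≡0 : ∀ m n → m + n ≡ 1 → m ≡ 0 ⊎ n ≡ 0
m+n≡1⇒m≡0⊎n≡0 zero    n e = inj₁ refl
m+n≡1⇒m≡0⊎n≡0 (suc m) n e = inj₂ (ℕ.m+n≡0⇒n≡0 m (ℕ.suc-injective e))

below-xor-suc⇒at-xor-suc : ∀ x B → does (x ℕ.<? B) xor does (suc x ℕ.<? B) ≡ true →
                            does (x ℕ.≟ B) xor does (suc x ℕ.≟ B) ≡ true
below-xor-suc⇒at-xor-suc x       zero          ()
below-xor-suc⇒at-xor-suc zero    (suc zero)    e = refl
below-xor-suc⇒at-xor-suc zero    (suc (suc B)) ()
below-xor-suc⇒at-xor-suc (suc x) (suc B)       e = below-xor-suc⇒at-xor-suc x B e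

below-xor⇒at-xor : ∀ x y B → ∣ x - y ∣ ≡ 1 →
                   does (x ℕ.<? B) xor does (y ℕ.<? B) ≡ true →
                   does (y ℕ.≟ B) xor does (x ℕ.≟ B) ≡ true
below-xor⇒at-xor x y B xy e with ∣m-n∣≡1⇒m≡1+n⊎1+m≡n x y xy
... | inj₁ refl = below-xor-suc⇒at-xor-suc y B (trans (xor-comm (does (y ℕ.<? B)) _) e)
... | inj₂ refl = trans (xor-comm (does (suc x ℕ.≟ B)) _) (below-xor-suc⇒at-xor-suc x B e)

distinct-neighbours⇒below-xor : ∀ {x y B} → ∣ x - B ∣ ≡ 1 → ∣ y - B ∣ ≡ 1 → x ≢ y →
                                does (x ℕ.<? B) xor does (y ℕ.<? B) ≡ true
distinct-neighbours⇒below-xor {x} {y} {B} xB yB x≢y with opposite-neighbours xB yB x≢y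
... | inj₁ (refl , refl) =
  cong₂ _xor_ (dec-false (x ℕ.<? B) (ℕ.<-asym (ℕ.n<1+n B))) (dec-true (y ℕ.<? B) (ℕ.n<1+n y))
... | inj₂ (refl , refl) =
  cong₂ _xor_ (dec-true (x ℕ.<? B) (ℕ.n<1+n x)) (dec-false (y ℕ.<? B) (ℕ.<-asym (ℕ.n<1+n B)))

SucMod : ℕ → ℕ → ℕ → Set
SucMod k x y = y ≡ suc x ⊎ (x ≡ k × y ≡ 0)

sucMod-twice-moves : ∀ {k x y z} → 2 ≤ k → SucMod k x y → SucMod k y z → z ≢ x
sucMod-twice-moves _             (inj₁ refl)          (inj₁ refl)          ()
sucMod-twice-moves (s≤s (s≤s _)) (inj₁ refl)          (inj₂ (refl , refl)) ()
sucMod-twice-moves (s≤s (s≤s _)) (inj₂ (refl , refl)) (inj₁ refl)          ()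
sucMod-twice-moves (s≤s _)       (inj₂ (refl , refl)) (inj₂ (() , _))

module _ {k : ℕ} where

  toℕ-next : (i : Fin (suc k)) → toℕ (next i) ≡ suc (toℕ i) % suc k
  toℕ-next i = toℕ-fromℕ< _

  toℕ-next-sucMod : (i : Fin (suc k)) → SucMod k (toℕ i) (toℕ (next i))
  toℕ-next-sucMod i with ℕ.m≤n⇒m<n∨m≡n (toℕ≤pred[n] i)
  ... | inj₁ i<k = inj₁ (trans (toℕ-next i) (m<n⇒m%n≡m (s≤s i<k)))
  ... | inj₂ i≡k = inj₂ (i≡k , trans (toℕ-next i)
                                 (trans (cong (λ x → suc x % suc k) i≡k) (n%n≡0 (suc k))))

  next-inject₁ : (i : Fin k) → next (inject₁ i) ≡ suc i
  next-inject₁ i = toℕ-injective (begin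
    toℕ (next (inject₁ i))        ≡⟨ toℕ-next (inject₁ i) ⟩
    suc (toℕ (inject₁ i)) % suc k ≡⟨ cong (λ x → suc x % suc k) (toℕ-inject₁ i) ⟩
    suc (toℕ i) % suc k           ≡⟨ m<n⇒m%n≡m (s≤s (toℕ<n i)) ⟩
    suc (toℕ i)                   ∎)
    where open ≡-Reasoning

  next-fromℕ : next (fromℕ k) ≡ zero
  next-fromℕ = toℕ-injective (begin
    toℕ (next (fromℕ k))        ≡⟨ toℕ-next (fromℕ k) ⟩
    suc (toℕ (fromℕ k)) % suc k ≡⟨ cong (λ x → suc x % suc k) (toℕ-fromℕ k) ⟩
    suc k % suc k               ≡⟨ n%n≡0 (suc k) ⟩
    0                           ∎)
    where open ≡-Reasoning

  next-surjective : (i : Fin (suc k)) → ∃ λ j → next j ≡ i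
  next-surjective zero    = fromℕ k , next-fromℕ
  next-surjective (suc i) = inject₁ i , next-inject₁ i

  next∘next≢id : 2 ≤ k → (i : Fin (suc k)) → next (next i) ≢ i
  next∘next≢id 2≤k i eq =
    sucMod-twice-moves 2≤k (toℕ-next-sucMod i) (toℕ-next-sucMod (next i)) (cong toℕ eq)

module _ {a ℓ} (M : CommutativeMonoid a ℓ) where
  open CommutativeMonoid M using (Carrier; _≈_; _∙_; comm; setoid)
  open import Algebra.Properties.CommutativeMonoid.Sum M using (sum; sum-init-last; sum-cong-≗)
  open import Relation.Binary.Reasoning.Setoid setoid

  sum-next : ∀ {k} (f : Vector Carrier (suc k)) → sum (f ∘ next) ≈ sum f
  sum-next {k} f = begin
    sum (f ∘ next)
      ≈⟨ sum-init-last (f ∘ next) ⟩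
    sum (f ∘ next ∘ inject₁) ∙ f (next (fromℕ k))
      ≡⟨ cong₂ _∙_ (sum-cong-≗ (cong f ∘ next-inject₁)) (cong f next-fromℕ) ⟩
    sum (f ∘ suc) ∙ f zero
      ≈⟨ comm _ _ ⟩
    sum f
      ∎

xor-commutativeMonoid : CommutativeMonoid 0ℓ 0ℓ
xor-commutativeMonoid = record
  { Carrier             = Bool
  ; _≈_                 = _≡_
  ; _∙_                 = _xor_
  ; ε                   = false
  ; isCommutativeMonoid = record
    { isMonoid = record
      { isSemigroup = record { isMagma = isMagma _xor_ ; assoc = xor-assoc }
      ; identity    = xor-identity
      }
    ; comm = xor-comm
    }
  }

open import Algebra.Properties.CommutativeMonoid.Sum xor-commutativeMonoid
  using (sum; sum-syntax; sum-cong-≗; ∑-distrib-+; ∑-comm; sum-replicate-zero)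

∑-δ : ∀ {k} (c : Fin k) → ∑[ a < k ] does (a ≟ c) ≡ true
∑-δ {suc k} zero    = cong not (sum-replicate-zero k)
∑-δ         (suc c) = ∑-δ c

module _ {k p} {P : Pred (Fin k) p} (P? : Decidable P) where

  ∑-does-none : (∀ a → ¬ P a) → ∑[ a < k ] does (P? a) ≡ false
  ∑-does-none ¬P = trans (sum-cong-≗ (λ a → dec-false (P? a) (¬P a))) (sum-replicate-zero k)

  ∑-does-unique : ∀ {c} → P c → (∀ {a} → P a → a ≡ c) →
                  ∑[ a < k ] does (P? a) ≡ true
  ∑-does-unique {c} Pc unique =
    trans (sum-cong-≗ (λ a → does-≡ (P? a) (map′ (λ { refl → Pc }) unique (a ≟ c)))) (∑-δ c)

∑-true-odd : ∀ {m} → Odd m → ∑[ a < m ] true ≡ true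
∑-true-odd (zero  , refl) = refl
∑-true-odd (suc k , refl) = begin
  ∑[ a < suc (2 * suc k) ] true ≡⟨ cong (λ l → ∑[ a < suc l ] true) (ℕ.*-suc 2 k) ⟩
  ∑[ a < 2 + suc (2 * k) ] true ≡⟨ not-involutive _ ⟩
  ∑[ a < suc (2 * k) ] true     ≡⟨ ∑-true-odd (k , refl) ⟩
  true                          ∎
  where open ≡-Reasoning

xor-cancel-middle : ∀ x y z → (x xor y) xor (y xor z) ≡ x xor z
xor-cancel-middle false false z = refl
xor-cancel-middle false true  z = not-involutive z
xor-cancel-middle true  false z = refl
xor-cancel-middle true  true  z = refl

∧-absorbs-implied : ∀ x y → (x ≡ true → y ≡ true) → x ∧ y ≡ x
∧-absorbs-implied false y _   = refl
∧-absorbs-implied true  y x⇒y = x⇒y refl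

module _ {m n : ℕ} where

  column row : Cell m n → ℕ
  column p = toℕ (proj₁ p)
  row    p = toℕ (proj₂ p)

  row-column⇒≡ : (p q : Cell m n) → row p ≡ row q → column p ≡ column q → p ≡ q
  row-column⇒≡ _ _ r c = ×-≡,≡→≡ (toℕ-injective c , toℕ-injective r)

  adj⇒horizontal⊎vertical : (p q : Cell m n) → Adj p q → Horizontal p q ⊎ Vertical p q
  adj⇒horizontal⊎vertical (a , r) (c , s) e with m+n≡1⇒m≡0⊎n≡0 ∣ toℕ a - toℕ c ∣ _ e
  ... | inj₁ ac = inj₂ (toℕ-injective (ℕ.∣m-n∣≡0⇒m≡n ac))
  ... | inj₂ rs = inj₁ (toℕ-injective (ℕ.∣m-n∣≡0⇒m≡n rs))

  horizontal-adj⇒∣column∣≡1 : (p q : Cell m n) → Adj p q → Horizontal p q →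
                              ∣ column p - column q ∣ ≡ 1
  horizontal-adj⇒∣column∣≡1 (a , r) (c , .r) e refl =
    trans (sym (ℕ.+-identityʳ _)) (subst (λ d → ∣ toℕ a - toℕ c ∣ + d ≡ 1) (ℕ.∣n-n∣≡0 (toℕ r)) e)

  vertical-adj⇒∣row∣≡1 : (p q : Cell m n) → Adj p q → Vertical p q → ∣ row p - row q ∣ ≡ 1
  vertical-adj⇒∣row∣≡1 (a , r) (.a , s) e refl =
    subst (λ d → d + ∣ toℕ r - toℕ s ∣ ≡ 1) (ℕ.∣n-n∣≡0 (toℕ a)) e

module _ {m n : ℕ} (b : Fin n) where

  below onRow : Cell m n → Bool
  below p = does (row p ℕ.<? toℕ b)
  onRow p = does (row p ℕ.≟ toℕ b)

  crosses : Cell m n → Cell m n → Bool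
  crosses p q = below p xor below q

  onRow≡true⇒inRow : (p : Cell m n) → onRow p ≡ true → proj₂ p ≡ b
  onRow≡true⇒inRow p e = toℕ-injective (ℕ.≡ᵇ⇒≡ (row p) (toℕ b) (subst T (sym e) tt))

  crossing-edge-meets-row : (p q : Cell m n) → Adj p q → crosses p q ≡ true →
                            onRow q xor onRow p ≡ true
  crossing-edge-meets-row p q pq e with adj⇒horizontal⊎vertical p q pq
  crossing-edge-meets-row p (c , .(proj₂ p)) pq e | inj₁ refl =
    contradiction (trans (sym (xor-same (below p))) e) λ ()
  crossing-edge-meets-row p q pq e | inj₂ ver =
    below-xor⇒at-xor (row p) (row q) (toℕ b) (vertical-adj⇒∣row∣≡1 p q pq ver) e

  vertical-pass-crosses-once : (u v w : Cell m n) → Adj u v → Adj v w →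
                               Vertical u v → Vertical v w → u ≢ w → proj₂ v ≡ b →
                               crosses u v xor crosses v w ≡ true
  vertical-pass-crosses-once u (c , .b) w uv vw ver₁ ver₂ u≢w refl =
    trans (xor-cancel-middle (below u) _ (below w))
      (distinct-neighbours⇒below-xor (vertical-adj⇒∣row∣≡1 u (c , b) uv ver₁)
        (trans (ℕ.∣-∣-comm (row w) _) (vertical-adj⇒∣row∣≡1 (c , b) w vw ver₂))
        (λ r → u≢w (row-column⇒≡ u w r (cong toℕ (trans ver₁ ver₂)))))

module _ {m n : ℕ} (C : HamiltonCycle m n) where

  private
    Position = Fin (suc (len-1 C))
    v = vertex C

  HorizontalAt VerticalAt : Position → Set
  HorizontalAt i = Horizontal (v i) (v (next i)) × Horizontal (v (next i)) (v (next (next i)))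
  VerticalAt   i = Vertical (v i) (v (next i)) × Vertical (v (next i)) (v (next (next i)))

  edge-horizontal⊎vertical : ∀ i → Horizontal (v i) (v (next i)) ⊎ Vertical (v i) (v (next i))
  edge-horizontal⊎vertical i = adj⇒horizontal⊎vertical (v i) (v (next i)) (adjacent C i)

  ¬turn⇒horizontal-forward : ∀ i → ¬ TurnAt C i →
    Horizontal (v i) (v (next i)) → Horizontal (v (next i)) (v (next (next i)))
  ¬turn⇒horizontal-forward i ¬turn hor with edge-horizontal⊎vertical (next i)
  ... | inj₁ hor′ = hor′
  ... | inj₂ ver  = contradiction (inj₁ (hor , ver)) ¬turn

  ¬turn⇒horizontal-backward : ∀ i → ¬ TurnAt C i →
    Horizontal (v (next i)) (v (next (next i))) → Horizontal (v i) (v (next i))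
  ¬turn⇒horizontal-backward i ¬turn hor with edge-horizontal⊎vertical i
  ... | inj₁ hor′ = hor′
  ... | inj₂ ver  = contradiction (inj₂ (ver , hor)) ¬turn

  ¬turn⇒straight : ∀ i → ¬ TurnAt C i → HorizontalAt i ⊎ VerticalAt i
  ¬turn⇒straight i ¬turn with edge-horizontal⊎vertical i | edge-horizontal⊎vertical (next i)
  ... | inj₁ hor | _         = inj₁ (hor , ¬turn⇒horizontal-forward i ¬turn hor)
  ... | inj₂ ver | inj₁ hor  = contradiction (inj₂ (ver , hor)) ¬turn
  ... | inj₂ ver | inj₂ ver′ = inj₂ (ver , ver′)

  vertex≢vertex-next² : ∀ i → v i ≢ v (next (next i))
  vertex≢vertex-next² i eq = next∘next≢id (s≤s⁻¹ (len≥3 C)) i (sym (injective C eq))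

  onRow-count : (b : Fin n) → ∑[ i < suc (len-1 C) ] onRow b (v i) ≡ ∑[ a < m ] true
  onRow-count b = begin
    ∑[ i < L ] onRow b (v i)                  ≡⟨ sum-cong-≗ (sym ∘ row-indicator ∘ v) ⟩
    ∑[ i < L ] ∑[ a < m ] does (v i ≟ᶜ (a , b)) ≡⟨ ∑-comm (λ i a → does (v i ≟ᶜ (a , b))) ⟩
    ∑[ a < m ] ∑[ i < L ] does (v i ≟ᶜ (a , b)) ≡⟨ sum-cong-≗ visited-once ⟩
    ∑[ a < m ] true                           ∎
    where
    open ≡-Reasoning
    L = suc (len-1 C)
    _≟ᶜ_ = ≡-dec _≟_ _≟_

    row-indicator : ∀ p → ∑[ a < m ] does (p ≟ᶜ (a , b)) ≡ onRow b p
    row-indicator (c , r) with toℕ r ℕ.≟ toℕ b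
    ... | yes r≡b = trans (∑-does-unique (λ a → (c , r) ≟ᶜ (a , b))
                             (cong (c ,_) (toℕ-injective r≡b)) (λ eq → sym (cong proj₁ eq)))
                          (sym (dec-true (toℕ r ℕ.≟ toℕ b) r≡b))
    ... | no  r≢b = trans (∑-does-none (λ a → (c , r) ≟ᶜ (a , b))
                             (λ a eq → r≢b (cong (toℕ ∘ proj₂) eq)))
                          (sym (dec-false (toℕ r ℕ.≟ toℕ b) r≢b))

    visited-once : ∀ a → ∑[ i < L ] does (v i ≟ᶜ (a , b)) ≡ true
    visited-once a with surjective C (a , b)
    ... | j , vj = ∑-does-unique (λ i → v i ≟ᶜ (a , b))
                     (vj refl) (λ eq → injective C (trans eq (sym (vj refl))))

  crossing : Fin n → Position → Bool
  crossing b i = crosses b (v i) (v (next i))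

  crossings-even : ∀ b → ∑[ i < suc (len-1 C) ] crossing b i ≡ false
  crossings-even b = begin
    ∑[ i < L ] (below b (v i) xor below b (v (next i)))
      ≡⟨ ∑-distrib-+ (below b ∘ v) (below b ∘ v ∘ next) ⟩
    S xor ∑[ i < L ] below b (v (next i))
      ≡⟨ cong (S xor_) (sum-next xor-commutativeMonoid (below b ∘ v)) ⟩
    S xor S
      ≡⟨ xor-same S ⟩
    false
      ∎
    where
    open ≡-Reasoning
    L = suc (len-1 C)
    S = ∑[ i < L ] below b (v i)

  turnAt? : ∀ i → Dec (TurnAt C i)
  turnAt? i =
          (proj₂ (v i) ≟ proj₂ (v (next i)) ×-dec proj₁ (v (next i)) ≟ proj₁ (v (next (next i))))
    ⊎-dec (proj₁ (v i) ≟ proj₁ (v (next i)) ×-dec proj₂ (v (next i)) ≟ proj₂ (v (next (next i))))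

  isTurn? : Decidable (IsTurn C)
  isTurn? p = any? λ i → ≡-dec _≟_ _≟_ (v (next i)) p ×-dec turnAt? i

module _ {m n : ℕ} (C : HamiltonCycle m n) (b : Fin n)
         (turnless : ∀ a → ¬ IsTurn C (a , b)) where

  private
    v = vertex C

  ¬turn-in-row : ∀ i → proj₂ (v (next i)) ≡ b → ¬ TurnAt C i
  ¬turn-in-row i r turn = turnless (proj₁ (v (next i))) (i , cong (proj₁ (v (next i)) ,_) r , turn)

  horizontal-pass-extends : ∀ i → proj₂ (v (next i)) ≡ b → HorizontalAt C i →
    ∃ λ j → proj₂ (v (next j)) ≡ b × HorizontalAt C j
          × column (v (next j)) ≡ suc (column (v (next i)))
  horizontal-pass-extends i r (hor₁ , hor₂)
    with opposite-neighbours
           (horizontal-adj⇒∣column∣≡1 (v i) (v (next i)) (adjacent C i) hor₁)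
           (trans (ℕ.∣-∣-comm (column (v (next (next i)))) _)
                  (horizontal-adj⇒∣column∣≡1 (v (next i)) (v (next (next i)))
                                             (adjacent C (next i)) hor₂))
           (λ c → vertex≢vertex-next² C i
                    (row-column⇒≡ (v i) (v (next (next i))) (cong toℕ (trans hor₁ hor₂)) c))
  ... | inj₂ (_ , w-right) =
    next i , r′ , (hor₂ , ¬turn⇒horizontal-forward C (next i) (¬turn-in-row (next i) r′) hor₂)
           , w-right
    where r′ = trans (sym hor₂) r
  ... | inj₁ (u-right , _) with next-surjective i
  ... | j , refl =
    j , r′ , (¬turn⇒horizontal-backward C j (¬turn-in-row j r′) hor₁ , hor₁) , u-right
    where r′ = trans hor₁ r

  no-horizontal-pass : ∀ i → proj₂ (v (next i)) ≡ b → ¬ HorizontalAt C i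
  no-horizontal-pass i r =
    go (m ∸ column (v (next i))) i r (ℕ.m+[n∸m]≡n (ℕ.<⇒≤ (toℕ<n (proj₁ (v (next i))))))
    where
    go : ∀ d i → proj₂ (v (next i)) ≡ b → column (v (next i)) + d ≡ m → ¬ HorizontalAt C i
    go zero    i r e _ = ℕ.<⇒≢ (toℕ<n (proj₁ (v (next i)))) (trans (sym (ℕ.+-identityʳ _)) e)
    go (suc d) i r e hor with horizontal-pass-extends i r hor
    ... | j , r′ , hor′ , col =
      go d j r′ (trans (cong (_+ d) col) (trans (sym (ℕ.+-suc _ d)) e)) hor′

  vertical-pass : ∀ i → proj₂ (v (next i)) ≡ b → VerticalAt C i
  vertical-pass i r with ¬turn⇒straight C i (¬turn-in-row i r)
  ... | inj₁ hor = contradiction hor (no-horizontal-pass i r)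
  ... | inj₂ ver = ver

  -- Double counting: split each crossing edge between its two ends, then regroup by cell.
  crossings≡row-length : ∑[ i < suc (len-1 C) ] crossing C b i ≡ ∑[ a < m ] true
  crossings≡row-length = begin
    ∑[ i < L ] c i
      ≡⟨ sum-cong-≗ (λ i → trans (sym (∧-absorbs-implied (c i) _ (edge-meets-row i)))
                                 (∧-comm (c i) _)) ⟩
    ∑[ i < L ] ((o (next i) xor o i) ∧ c i)
      ≡⟨ sum-cong-≗ (λ i → ∧-distribʳ-xor (c i) (o (next i)) (o i)) ⟩
    ∑[ i < L ] (o (next i) ∧ c i xor o i ∧ c i)
      ≡⟨ ∑-distrib-+ (λ i → o (next i) ∧ c i) (λ i → o i ∧ c i) ⟩
    S xor ∑[ i < L ] (o i ∧ c i)
      ≡⟨ cong (S xor_) (sym (sum-next xor-commutativeMonoid (λ i → o i ∧ c i))) ⟩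
    S xor ∑[ i < L ] (o (next i) ∧ c (next i))
      ≡⟨ sym (∑-distrib-+ (λ i → o (next i) ∧ c i) (λ i → o (next i) ∧ c (next i))) ⟩
    ∑[ i < L ] (o (next i) ∧ c i xor o (next i) ∧ c (next i))
      ≡⟨ sum-cong-≗ (λ i → sym (∧-distribˡ-xor (o (next i)) (c i) (c (next i)))) ⟩
    ∑[ i < L ] (o (next i) ∧ (c i xor c (next i)))
      ≡⟨ sum-cong-≗ (λ i → ∧-absorbs-implied (o (next i)) _ (pass-crosses-once i)) ⟩
    ∑[ i < L ] o (next i)
      ≡⟨ sum-next xor-commutativeMonoid o ⟩
    ∑[ i < L ] o i
      ≡⟨ onRow-count C b ⟩
    ∑[ a < m ] true
      ∎
    where
    open ≡-Reasoning
    L = suc (len-1 C)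
    c = crossing C b
    o = onRow b ∘ v
    S = ∑[ i < L ] (o (next i) ∧ c i)

    edge-meets-row : ∀ i → c i ≡ true → o (next i) xor o i ≡ true
    edge-meets-row i = crossing-edge-meets-row b (v i) (v (next i)) (adjacent C i)

    pass-crosses-once : ∀ i → o (next i) ≡ true → c i xor c (next i) ≡ true
    pass-crosses-once i on =
      vertical-pass-crosses-once b (v i) (v (next i)) (v (next (next i)))
        (adjacent C i) (adjacent C (next i)) (proj₁ ver) (proj₂ ver) (vertex≢vertex-next² C i) r
      where
      r   = onRow≡true⇒inRow b (v (next i)) on
      ver = vertical-pass i r

  turnless-row⇒¬odd : ¬ Odd m
  turnless-row⇒¬odd odd
    with trans (sym (crossings-even C b)) (trans crossings≡row-length (∑-true-odd odd))
  ... | ()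

lemma6 : (m n : ℕ) → Odd m → (C : HamiltonCycle m n) →
           (b : Fin n) → ∃ λ (a : Fin m) → IsTurn C (a , b)
lemma6 m n odd C b =
  decidable-stable (any? λ a → isTurn? C (a , b))
                   (λ no-turn → turnless-row⇒¬odd C b (λ a turn → no-turn (a , turn)) odd)
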